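{- Let $q$ be a prime power with $q=3m+1$. Suppose $a\in D_{i}^{3}$ for $i=1$ or $i=2$, and let $M=\begin{pmatrix}1 & a^{2} & a\\ (a^{2})^{ -1} & 1 & a^{ -1}\\ a^{ -1} & a & 1\end{pmatrix}$. Then $(C_{1}^{(q,3)})^{M}$ is the adjacency matrix of a directed strongly regular graph with parameters $(3(3m+1),\,3m,\,m,\,m-1,\,m)$.
   Context: Let $\alpha$ be a primitive element of $\mathbb{F}_q$; for $e\mid q-1$ the cyclotomic classes of order $e$ are $D_{0}^{e}=\langle\alpha^{e}\rangle$ and $D_{i}^{e}=\alpha^{i}D_{0}^{e}$, $i=1,\dots,e-1$. For $\sigma\in\mathbb{F}_q$, $C_{\sigma}^{(q,e)}$ is the $0$-$1$ matrix with rows and columns indexed by $\mathbb{F}_q$ whose $(x,y)$ entry is $1$ iff $x\in\sigma y+D_{0}^{e}$; for an $e\times e$ matrix $M$ over $\mathbb{F}_q$, $(C_{1}^{(q,e)})^{M}$ is the block matrix whose $(i,j)$ block is $C_{M_{ij}}^{(q,e)}$. A directed graph with adjacency matrix $A$ on $v$ vertices is directed strongly regular with parameters $(v,k,t,\lambda,\mu)$ if $A^{2}=tI+\lambda A+\mu(J-I-A)$ and $AJ=JA=kJ$. -}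

module Defs where

open import Data.Nat as ℕ using (ℕ; zero; suc)
open import Data.Nat.Primality using (Prime)
open import Data.Integer as ℤ using (ℤ; +_)
open import Data.Fin as Fin using (Fin; toℕ; remQuot)
open import Data.Fin.Properties using (any?)
open import Data.Product using (Σ; ∃; _×_; _,_)
open import Relation.Nullary using (¬_; Dec)
open import Relation.Nullary.Decidable using (⌊_⌋)
open import Relation.Binary.PropositionalEquality using (_≡_; _≢_)
open import Algebra.Structures using (IsCommutativeRing)
open import Data.Bool using (if_then_else_)

IsPrimePower : ℕ → Set
IsPrimePower q = Σ ℕ λ p → Σ ℕ λ k → Prime p × q ≡ p ℕ.^ suc k

record FiniteField (q : ℕ) : Set where
  infixl 6 _+_
  infixl 7 _*_
  field
    _+_ _*_ : Fin q → Fin q → Fin q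
    -_      : Fin q → Fin q
    0# 1#   : Fin q
    isCommutativeRing : IsCommutativeRing _≡_ _+_ _*_ -_ 0# 1#
    inv     : Fin q → Fin q
    0≢1     : 0# ≢ 1#
    inv-r   : ∀ x → x ≢ 0# → x * inv x ≡ 1#

  _^_ : Fin q → ℕ → Fin q
  x ^ zero  = 1#
  x ^ suc n = x * (x ^ n)

  IsPrimitive : Fin q → Set
  IsPrimitive α = α ≢ 0# × (∀ x → x ≢ 0# → ∃ λ k → x ≡ α ^ k)

  _∈D[_,_]_ : Fin q → ℕ → ℕ → Fin q → Set
  x ∈D[ e , i ] α = ∃ λ k → x ≡ (α ^ i) * (α ^ (e ℕ.* k))

  -- decidable (finite-enumeration) form of membership in D_0^e = ⟨α^e⟩:
  -- x = α^(e k) for some k < q (this exhausts ⟨α^e⟩ since α^(q-1) = 1)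
  inD0? : (α : Fin q) (e : ℕ) (x : Fin q) →
          Dec (Σ (Fin q) λ k → x ≡ α ^ (e ℕ.* toℕ k))
  inD0? α e x = any? (λ k → x Fin.≟ α ^ (e ℕ.* toℕ k))

  C : (α : Fin q) (e : ℕ) (σ : Fin q) → Fin q → Fin q → ℤ
  C α e σ x y = if ⌊ inD0? α e (x + (- (σ * y))) ⌋ then + 1 else + 0

  -- block matrix (C_1^(q,e))^M, M an e×e matrix over F_q; the vertex
  -- (i , x) ∈ Fin e × F_q is indexed by combine i x ∈ Fin (e * q)
  blockC : (α : Fin q) (e : ℕ) (M : Fin e → Fin e → Fin q) →
           Fin (e ℕ.* q) → Fin (e ℕ.* q) → ℤ
  blockC α e M u w with remQuot {e} q u | remQuot {e} q w
  ... | (i , x) | (j , y) = C α e (M i j) x y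

Mat : ℕ → Set
Mat n = Fin n → Fin n → ℤ

∑ : ∀ {n} → (Fin n → ℤ) → ℤ
∑ {zero}  f = + 0
∑ {suc n} f = f Fin.zero ℤ.+ ∑ (λ i → f (Fin.suc i))

_⊗_ : ∀ {n} → Mat n → Mat n → Mat n
(A ⊗ B) i j = ∑ (λ l → A i l ℤ.* B l j)

Iₘ : ∀ {n} → Mat n
Iₘ i j = if ⌊ i Fin.≟ j ⌋ then + 1 else + 0

Jₘ : ∀ {n} → Mat n
Jₘ i j = + 1

IsDSRG : (v : ℕ) (k t λ' μ : ℤ) → Mat v → Set
IsDSRG v k t λ' μ A =
  (∀ i j → (A ⊗ A) i j ≡
     t ℤ.* Iₘ i j ℤ.+ λ' ℤ.* A i j ℤ.+ μ ℤ.* (Jₘ i j ℤ.- Iₘ i j ℤ.- A i j))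
  × (∀ i j → (A ⊗ Jₘ) i j ≡ k ℤ.* Jₘ i j)
  × (∀ i j → (Jₘ ⊗ A) i j ≡ k ℤ.* Jₘ i j)

matM : ∀ {q} → FiniteField q → Fin q → Fin 3 → Fin 3 → Fin q
matM {q} F a = M
  where
  open FiniteField F
  M : Fin 3 → Fin 3 → Fin q
  M Fin.zero Fin.zero = 1#
  M Fin.zero (Fin.suc Fin.zero) = a * a
  M Fin.zero (Fin.suc (Fin.suc Fin.zero)) = a
  M (Fin.suc Fin.zero) Fin.zero = inv (a * a)
  M (Fin.suc Fin.zero) (Fin.suc Fin.zero) = 1#
  M (Fin.suc Fin.zero) (Fin.suc (Fin.suc Fin.zero)) = inv a
  M (Fin.suc (Fin.suc Fin.zero)) Fin.zero = inv a
  M (Fin.suc (Fin.suc Fin.zero)) (Fin.suc Fin.zero) = a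
  M (Fin.suc (Fin.suc Fin.zero)) (Fin.suc (Fin.suc Fin.zero)) = 1#

module Submission where

-- The proof goes through a general block construction.  Let q = eM + 1, let χ
-- be the indicator of D = D₀^e, and let B_ij = g_i h_j with h_j g_j = 1; the
-- entry of A = (C₁^(q,e))^B at vertices (i, x), (k, z) is χ(x - B_ik z).  Assume
--   (T)  for every v ≠ 0 exactly one g_j v lies in D.
-- Counting pairs (j, v) with g_j v ∈ D using (T) gives |D| = M.  Row and column
-- sums are then M per block, by affine changes of variable.  Substituting
-- y = g_j (v + h_k z) turns the number of 2-walks from (i, x) to (k, z) into
-- Σ_v χ(u - g_i v) · #{j : g_j v ∈ D} with u = x - B_ik z, which by (T) is
-- M - χ(u).  So A² = MJ - A, the DSRG equation with (t, λ, μ) = (M, M - 1, M).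

open import Defs
open import Data.Nat as ℕ using (ℕ; zero; suc; NonZero; _<_; _≤_)
import Data.Nat.Properties as ℕP
open import Data.Nat.DivMod using (_%_; _/_; m%n<n; m/n≤m; [m+kn]%n≡m%n; m∣n⇒o%n%m≡o%m; m≡m%n+[m/n]*n; m*[n/m]≡n)
open import Data.Nat.Divisibility using (_∣_; m∣m*n; m%n≡0⇒n∣m; n∣m⇒m%n≡0)
open import Data.Nat.Tactic.RingSolver as ℕSolver using ()
open import Data.Integer using (ℤ; +_; -[1+_]) renaming (_+_ to _+ℤ_; _*_ to _*ℤ_; _-_ to _-ℤ_)
import Data.Integer.Properties as ℤP
open import Data.Integer.Tactic.RingSolver as ℤSolver using ()
open import Data.Fin as Fin using (Fin; toℕ; fromℕ<; punchIn; punchOut; combine; remQuot; _↑ˡ_; _↑ʳ_)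
open import Data.Fin.Properties using (pigeonhole; punchInᵢ≢i; punchIn-injective; punchOut-injective; toℕ-fromℕ<; toℕ<n; remQuot-combine; combine-remQuot)
open import Data.Fin.Permutation using (permutation)
open import Data.Fin.Patterns using (0F; 1F; 2F)
open import Data.Product using (Σ; ∃; _×_; _,_; proj₁; proj₂)
open import Data.Sum using (_⊎_; inj₁; inj₂)
open import Data.Bool using (if_then_else_)
open import Data.Empty using (⊥; ⊥-elim)
open import Function using (_∘_)
open import Relation.Nullary using (¬_; Dec; yes; no)
open import Relation.Nullary.Decidable using (⌊_⌋)
open import Relation.Binary.PropositionalEquality
open import Relation.Binary.Definitions using (tri<; tri≈; tri>)
open import Algebra.Bundles using (CommutativeRing)

indicator : ∀ {A : Set} → Dec A → ℤ
indicator d = if ⌊ d ⌋ then + 1 else + 0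

indicator-yes : ∀ {A : Set} (d : Dec A) → A → indicator d ≡ + 1
indicator-yes (yes _) _ = refl
indicator-yes (no ¬a) a = ⊥-elim (¬a a)

indicator-no : ∀ {A : Set} (d : Dec A) → ¬ A → indicator d ≡ + 0
indicator-no (yes a) ¬a = ⊥-elim (¬a a)
indicator-no (no _) _ = refl


module FiniteSums where
  open import Algebra.Properties.Semiring.Sum ℤP.+-*-semiring
    using (sum; sum-cong-≗; ∑-comm; sum-permute; sum-remove; *-distribˡ-sum)
  open ≡-Reasoning

  ∑≡sum : ∀ {n} (f : Fin n → ℤ) → ∑ f ≡ sum f
  ∑≡sum {zero} f = refl
  ∑≡sum {suc n} f = cong (f Fin.zero +ℤ_) (∑≡sum (f ∘ Fin.suc))

  ∑-cong : ∀ {n} {f g : Fin n → ℤ} → (∀ i → f i ≡ g i) → ∑ f ≡ ∑ g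
  ∑-cong {f = f} {g} f≗g = trans (∑≡sum f) (trans (sum-cong-≗ f≗g) (sym (∑≡sum g)))

  ∑-*ˡ : ∀ {n} (c : ℤ) (f : Fin n → ℤ) → ∑ (λ i → c *ℤ f i) ≡ c *ℤ ∑ f
  ∑-*ˡ c f = begin
    ∑ (λ i → c *ℤ f i)   ≡⟨ ∑≡sum (λ i → c *ℤ f i) ⟩
    sum (λ i → c *ℤ f i) ≡⟨ sym (*-distribˡ-sum c f) ⟩
    c *ℤ sum f           ≡⟨ cong (c *ℤ_) (sym (∑≡sum f)) ⟩
    c *ℤ ∑ f             ∎

  ∑-const : ∀ n (c : ℤ) → ∑ {n} (λ _ → c) ≡ + n *ℤ c
  ∑-const zero c = sym (ℤP.*-zeroˡ c)
  ∑-const (suc n) c = trans (cong (c +ℤ_) (∑-const n c)) (sym (ℤP.suc-* (+ n) c))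

  ∑-swap : ∀ {m n} (f : Fin m → Fin n → ℤ) →
           ∑ (λ i → ∑ (λ j → f i j)) ≡ ∑ (λ j → ∑ (λ i → f i j))
  ∑-swap f = begin
    ∑ (λ i → ∑ (f i))                    ≡⟨ ∑-cong (λ i → ∑≡sum (f i)) ⟩
    ∑ (λ i → sum (f i))                  ≡⟨ ∑≡sum (λ i → sum (f i)) ⟩
    sum (λ i → sum (f i))                ≡⟨ ∑-comm f ⟩
    sum (λ j → sum (λ i → f i j))        ≡⟨ sym (∑≡sum (λ j → sum (λ i → f i j))) ⟩
    ∑ (λ j → sum (λ i → f i j))          ≡⟨ ∑-cong (λ j → sym (∑≡sum (λ i → f i j))) ⟩
    ∑ (λ j → ∑ (λ i → f i j))            ∎

  ∑-reindex : ∀ {n} (f : Fin n → ℤ) (φ ψ : Fin n → Fin n) →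
              (∀ y → φ (ψ y) ≡ y) → (∀ y → ψ (φ y) ≡ y) → ∑ (f ∘ φ) ≡ ∑ f
  ∑-reindex f φ ψ φψ ψφ = begin
    ∑ (f ∘ φ)   ≡⟨ ∑≡sum (f ∘ φ) ⟩
    sum (f ∘ φ) ≡⟨ sym (sum-permute f (permutation φ ψ φψ ψφ)) ⟩
    sum f       ≡⟨ sym (∑≡sum f) ⟩
    ∑ f         ∎

  ∑-puncture : ∀ {n} (c : Fin (suc n)) (f : Fin (suc n) → ℤ) →
               ∑ f ≡ f c +ℤ ∑ (λ j → f (punchIn c j))
  ∑-puncture c f = begin
    ∑ f                                   ≡⟨ ∑≡sum f ⟩
    sum f                                 ≡⟨ sum-remove {i = c} f ⟩
    f c +ℤ sum (λ j → f (punchIn c j))    ≡⟨ cong (f c +ℤ_) (sym (∑≡sum (λ j → f (punchIn c j)))) ⟩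
    f c +ℤ ∑ (λ j → f (punchIn c j))      ∎

  ∑-++ : ∀ m n (f : Fin (m ℕ.+ n) → ℤ) →
         ∑ f ≡ ∑ (λ i → f (i ↑ˡ n)) +ℤ ∑ (λ j → f (m ↑ʳ j))
  ∑-++ zero n f = sym (ℤP.+-identityˡ _)
  ∑-++ (suc m) n f = trans (cong (f Fin.zero +ℤ_) (∑-++ m n (f ∘ Fin.suc)))
                           (sym (ℤP.+-assoc (f Fin.zero) _ _))

  ∑-combine : ∀ {m n} (f : Fin (m ℕ.* n) → ℤ) →
              ∑ f ≡ ∑ (λ i → ∑ (λ x → f (combine {m} {n} i x)))
  ∑-combine {zero} f = refl
  ∑-combine {suc m} {n} f =
    trans (∑-++ n (m ℕ.* n) f) (cong (∑ (λ x → f (x ↑ˡ m ℕ.* n)) +ℤ_) (∑-combine {m} {n} (λ w → f (n ↑ʳ w))))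


module FieldFacts {q : ℕ} (F : FiniteField q) where
  open FiniteField F
  open FiniteSums

  ring : CommutativeRing _ _
  ring = record { isCommutativeRing = isCommutativeRing }

  open CommutativeRing ring public
    using (+-comm; +-identityʳ; *-comm; *-assoc; *-identityˡ; *-identityʳ; zeroʳ; distribˡ)
  open CommutativeRing ring using (+-assoc; +-group)
  open import Algebra.Properties.Group +-group
    using (⁻¹-involutive; ⁻¹-anti-homo-∙; ε⁻¹≈ε; //-rightDividesˡ; //-rightDividesʳ)
  open ≡-Reasoning

  infixl 6 _-_
  _-_ : Fin q → Fin q → Fin q
  x - y = x + - y

  sub-add-cancel : ∀ y c → (y - c) + c ≡ y
  sub-add-cancel y c = //-rightDividesˡ c y

  add-sub-cancel : ∀ y c → (y + c) - c ≡ y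
  add-sub-cancel y c = //-rightDividesʳ c y

  sub-zero : ∀ x → x - 0# ≡ x
  sub-zero x = trans (cong (λ t → x + t) ε⁻¹≈ε) (+-identityʳ x)

  sub-sub : ∀ x w → x - (x - w) ≡ w
  sub-sub x w = begin
    x + - (x + - w)   ≡⟨ cong (λ t → x + t) (⁻¹-anti-homo-∙ x (- w)) ⟩
    x + (- - w + - x) ≡⟨ cong (λ t → x + (t + - x)) (⁻¹-involutive w) ⟩
    x + (w - x)       ≡⟨ +-comm x (w - x) ⟩
    (w - x) + x       ≡⟨ sub-add-cancel w x ⟩
    w                 ∎

  sub-+ : ∀ x a b → x - (a + b) ≡ (x - b) - a
  sub-+ x a b = trans (cong (λ t → x + t) (⁻¹-anti-homo-∙ a b)) (sym (+-assoc x (- b) (- a)))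

  unit⇒≢0 : ∀ {x y} → x * y ≡ 1# → y ≢ 0#
  unit⇒≢0 {x} xy≡1 y≡0 = 0≢1 (trans (sym (zeroʳ x)) (trans (cong (x *_) (sym y≡0)) xy≡1))

  inv-l : ∀ {x} → x ≢ 0# → inv x * x ≡ 1#
  inv-l {x} x≢0 = trans (*-comm (inv x) x) (inv-r x x≢0)

  unit-cancel : ∀ {c d} y → c * d ≡ 1# → c * (d * y) ≡ y
  unit-cancel {c} {d} y cd≡1 = trans (sym (*-assoc c d y)) (trans (cong (_* y) cd≡1) (*-identityˡ y))

  *-cancelˡ : ∀ {c} y z → c ≢ 0# → c * y ≡ c * z → y ≡ z
  *-cancelˡ {c} y z c≢0 cy≡cz = begin
    y                 ≡⟨ sym (unit-cancel y (inv-l c≢0)) ⟩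
    inv c * (c * y)   ≡⟨ cong (inv c *_) cy≡cz ⟩
    inv c * (c * z)   ≡⟨ unit-cancel z (inv-l c≢0) ⟩
    z                 ∎

  *-≢0 : ∀ {x y} → x ≢ 0# → y ≢ 0# → x * y ≢ 0#
  *-≢0 {x} {y} x≢0 y≢0 xy≡0 = y≢0 (*-cancelˡ y 0# x≢0 (trans xy≡0 (sym (zeroʳ x))))

  inv-unique : ∀ {x y} → x * y ≡ 1# → y ≡ inv x
  inv-unique {x} {y} xy≡1 =
    *-cancelˡ y (inv x) x≢0 (trans xy≡1 (sym (inv-r x x≢0)))
    where
    x≢0 : x ≢ 0#
    x≢0 = unit⇒≢0 (trans (*-comm y x) xy≡1)

  ^-+ : ∀ x a b → x ^ (a ℕ.+ b) ≡ x ^ a * x ^ b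
  ^-+ x zero b = sym (*-identityˡ _)
  ^-+ x (suc a) b = trans (cong (x *_) (^-+ x a b)) (sym (*-assoc x _ _))

  ^-≢0 : ∀ {x} n → x ≢ 0# → x ^ n ≢ 0#
  ^-≢0 zero x≢0 = 0≢1 ∘ sym
  ^-≢0 (suc n) x≢0 = *-≢0 x≢0 (^-≢0 n x≢0)

  ^-mod : ∀ {x} d .{{_ : NonZero d}} → x ^ d ≡ 1# → ∀ n → x ^ n ≡ x ^ (n % d)
  ^-mod {x} d x^d≡1 n = begin
    x ^ n                                   ≡⟨ cong (x ^_) (m≡m%n+[m/n]*n n d) ⟩
    x ^ (n % d ℕ.+ (n / d) ℕ.* d)           ≡⟨ ^-+ x (n % d) _ ⟩
    x ^ (n % d) * x ^ ((n / d) ℕ.* d)       ≡⟨ cong (x ^ (n % d) *_) (periodic (n / d)) ⟩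
    x ^ (n % d) * 1#                        ≡⟨ *-identityʳ _ ⟩
    x ^ (n % d)                             ∎
    where
    periodic : ∀ j → x ^ (j ℕ.* d) ≡ 1#
    periodic zero = refl
    periodic (suc j) = begin
      x ^ (d ℕ.+ j ℕ.* d)      ≡⟨ ^-+ x d (j ℕ.* d) ⟩
      x ^ d * x ^ (j ℕ.* d)    ≡⟨ cong₂ _*_ x^d≡1 (periodic j) ⟩
      1# * 1#                  ≡⟨ *-identityˡ 1# ⟩
      1#                       ∎

  ^-period : ∀ {x} a b → x ≢ 0# → a ≤ b → x ^ a ≡ x ^ b → x ^ (b ℕ.∸ a) ≡ 1#
  ^-period {x} a b x≢0 a≤b x^a≡x^b = sym (*-cancelˡ 1# _ (^-≢0 a x≢0) (begin
    x ^ a * 1#                    ≡⟨ *-identityʳ _ ⟩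
    x ^ a                         ≡⟨ x^a≡x^b ⟩
    x ^ b                         ≡⟨ cong (x ^_) (sym (ℕP.m+[n∸m]≡n a≤b)) ⟩
    x ^ (a ℕ.+ (b ℕ.∸ a))         ≡⟨ ^-+ x a (b ℕ.∸ a) ⟩
    x ^ a * x ^ (b ℕ.∸ a)         ∎))

  ∑-translate : ∀ (f : Fin q → ℤ) c → ∑ (λ y → f (y + c)) ≡ ∑ f
  ∑-translate f c = ∑-reindex f (λ y → y + c) (λ y → y - c) (λ y → sub-add-cancel y c) (λ y → add-sub-cancel y c)

  ∑-scale : ∀ (f : Fin q → ℤ) {c d} → d * c ≡ 1# → ∑ (λ v → f (c * v)) ≡ ∑ f
  ∑-scale f {c} {d} dc≡1 =
    ∑-reindex f (c *_) (d *_) (λ y → unit-cancel y (trans (*-comm c d) dc≡1)) (λ v → unit-cancel v dc≡1)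

  ∑-reflect : ∀ (f : Fin q → ℤ) x {σ τ} → τ * σ ≡ 1# → ∑ (λ y → f (x - σ * y)) ≡ ∑ f
  ∑-reflect f x {σ} {τ} τσ≡1 = ∑-reindex f (λ y → x - σ * y) (λ y → τ * (x - y)) there back
    where
    there : ∀ y → x - σ * (τ * (x - y)) ≡ y
    there y = trans (cong (λ t → x - t) (unit-cancel (x - y) (trans (*-comm σ τ) τσ≡1))) (sub-sub x y)
    back : ∀ y → τ * (x - (x - σ * y)) ≡ y
    back y = trans (cong (τ *_) (sub-sub x (σ * y))) (unit-cancel y τσ≡1)

no-field-of-size-one : ¬ FiniteField 1
no-field-of-size-one F = FiniteField.0≢1 F (trans (only _) (sym (only _)))
  where
  only : (x : Fin 1) → x ≡ Fin.zero
  only Fin.zero = refl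


module PrimitiveElement (N : ℕ) .{{_ : NonZero N}} (F : FiniteField (suc N))
                        (α : Fin (suc N)) (prim : FiniteField.IsPrimitive F α) where
  open FiniteField F
  open FieldFacts F
  open ≡-Reasoning

  α≢0 : α ≢ 0#
  α≢0 = proj₁ prim

  -- No 0 < d < N has α^d = 1: the N nonzero elements, all of the form
  -- α^k = α^(k mod d), would then inject into the d residues mod d.
  no-short-period : ∀ d → 0 < d → d < N → α ^ d ≢ 1#
  no-short-period d@(suc _) _ d<N α^d≡1 = collision (pigeonhole d<N residue)
    where
    nonzero : Fin N → Fin (suc N)
    nonzero = punchIn 0#
    log : Fin N → ℕ
    log i = proj₁ (proj₂ prim (nonzero i) (punchInᵢ≢i 0# i))
    residue : Fin N → Fin d
    residue i = fromℕ< (m%n<n (log i) d)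
    nonzero-via-residue : ∀ i → nonzero i ≡ α ^ toℕ (residue i)
    nonzero-via-residue i = begin
      nonzero i                  ≡⟨ proj₂ (proj₂ prim (nonzero i) (punchInᵢ≢i 0# i)) ⟩
      α ^ log i                  ≡⟨ ^-mod d α^d≡1 (log i) ⟩
      α ^ (log i % d)            ≡⟨ cong (α ^_) (sym (toℕ-fromℕ< (m%n<n (log i) d))) ⟩
      α ^ toℕ (residue i)        ∎
    collision : (∃ λ i → ∃ λ j → i Fin.< j × residue i ≡ residue j) → ⊥
    collision (i , j , i<j , same) = ℕP.<-irrefl (cong toℕ i≡j) i<j
      where
      i≡j : i ≡ j
      i≡j = punchIn-injective 0# i j
        (trans (nonzero-via-residue i) (trans (cong (λ r → α ^ toℕ r) same) (sym (nonzero-via-residue j))))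

  -- Some 0 < d ≤ N has α^d = 1: two of the N + 1 nonzero powers α⁰, …, α^N coincide.
  period-exists : ∃ λ d → 0 < d × d ≤ N × α ^ d ≡ 1#
  period-exists = collision (pigeonhole (ℕP.n<1+n N) index)
    where
    power≢0 : (k : Fin (suc N)) → 0# ≢ α ^ toℕ k
    power≢0 k = ^-≢0 (toℕ k) α≢0 ∘ sym
    index : Fin (suc N) → Fin N
    index k = punchOut (power≢0 k)
    collision : (∃ λ i → ∃ λ j → i Fin.< j × index i ≡ index j) → ∃ λ d → 0 < d × d ≤ N × α ^ d ≡ 1#
    collision (i , j , i<j , same) =
      toℕ j ℕ.∸ toℕ i , ℕP.m<n⇒0<n∸m i<j ,
      ℕP.≤-trans (ℕP.m∸n≤m (toℕ j) (toℕ i)) (ℕP.≤-pred (toℕ<n j)) ,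
      ^-period (toℕ i) (toℕ j) α≢0 (ℕP.<⇒≤ i<j) (punchOut-injective (power≢0 i) (power≢0 j) same)

  α^N≡1 : α ^ N ≡ 1#
  α^N≡1 with period-exists
  ... | d , 0<d , d≤N , α^d≡1 with ℕP.m≤n⇒m<n∨m≡n d≤N
  ...   | inj₁ d<N = ⊥-elim (no-short-period d 0<d d<N α^d≡1)
  ...   | inj₂ refl = α^d≡1

  pow-mod : ∀ n → α ^ n ≡ α ^ (n % N)
  pow-mod = ^-mod N α^N≡1

  distinct-residues : ∀ {r r'} → r < r' → r' < N → α ^ r ≢ α ^ r'
  distinct-residues {r} {r'} r<r' r'<N α^r≡α^r' =
    no-short-period (r' ℕ.∸ r) (ℕP.m<n⇒0<n∸m r<r') (ℕP.≤-<-trans (ℕP.m∸n≤m r' r) r'<N)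
      (^-period r r' α≢0 (ℕP.<⇒≤ r<r') α^r≡α^r')

  ^-injective-mod : ∀ n n' → α ^ n ≡ α ^ n' → n % N ≡ n' % N
  ^-injective-mod n n' α^n≡α^n'
    with ℕP.<-cmp (n % N) (n' % N) | trans (sym (pow-mod n)) (trans α^n≡α^n' (pow-mod n'))
  ... | tri≈ _ same _ | _ = same
  ... | tri< r<r' _ _ | α^r≡α^r' = ⊥-elim (distinct-residues r<r' (m%n<n n' N) α^r≡α^r')
  ... | tri> _ _ r>r' | α^r≡α^r' = ⊥-elim (distinct-residues r>r' (m%n<n n N) (sym α^r≡α^r'))

module ClassIndicator {q : ℕ} (F : FiniteField q) (α : Fin q) (e : ℕ) where
  open FiniteField F
  open FieldFacts F

  InD0 : Fin q → Set
  InD0 x = Σ (Fin q) λ k → x ≡ α ^ (e ℕ.* toℕ k)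

  χ : Fin q → ℤ
  χ x = indicator (inD0? α e x)

  χ-zero : α ≢ 0# → χ 0# ≡ + 0
  χ-zero α≢0 = indicator-no (inD0? α e 0#) (λ (k , 0≡α^ek) → ^-≢0 (e ℕ.* toℕ k) α≢0 (sym 0≡α^ek))


module CyclotomicPowers (e M : ℕ) .{{_ : NonZero e}} .{{_ : NonZero M}}
                        (F : FiniteField (suc (e ℕ.* M))) (α : Fin (suc (e ℕ.* M)))
                        (prim : FiniteField.IsPrimitive F α) where
  N : ℕ
  N = e ℕ.* M

  instance
    N≢0 : NonZero N
    N≢0 = ℕP.m*n≢0 e M

  open FiniteField F
  open PrimitiveElement N F α prim
  open ClassIndicator F α e
  open ≡-Reasoning

  mod-N-mod-e : ∀ E → E % N % e ≡ E % e
  mod-N-mod-e E = m∣n⇒o%n%m≡o%m e N E (m∣m*n M)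

  power-in-D0 : ∀ E → E % e ≡ 0 → InD0 (α ^ E)
  power-in-D0 E E%e≡0 = fromℕ< K<q , (begin
    α ^ E                           ≡⟨ pow-mod E ⟩
    α ^ (E % N)                     ≡⟨ cong (α ^_) (sym (m*[n/m]≡n e∣E%N)) ⟩
    α ^ (e ℕ.* K)                   ≡⟨ cong (λ t → α ^ (e ℕ.* t)) (sym (toℕ-fromℕ< K<q)) ⟩
    α ^ (e ℕ.* toℕ (fromℕ< K<q))    ∎)
    where
    K : ℕ
    K = E % N / e
    e∣E%N : e ∣ E % N
    e∣E%N = m%n≡0⇒n∣m (E % N) e (trans (mod-N-mod-e E) E%e≡0)
    K<q : K < suc N
    K<q = ℕP.≤-<-trans (m/n≤m (E % N) e) (ℕP.<-trans (m%n<n E N) (ℕP.n<1+n N))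

  power-in-D0⇒ : ∀ E → InD0 (α ^ E) → E % e ≡ 0
  power-in-D0⇒ E (k , α^E≡α^ek) = begin
    E % e                  ≡⟨ sym (mod-N-mod-e E) ⟩
    E % N % e              ≡⟨ cong (_% e) (^-injective-mod E (e ℕ.* toℕ k) α^E≡α^ek) ⟩
    e ℕ.* toℕ k % N % e    ≡⟨ mod-N-mod-e (e ℕ.* toℕ k) ⟩
    e ℕ.* toℕ k % e        ≡⟨ n∣m⇒m%n≡0 (e ℕ.* toℕ k) e (m∣m*n (toℕ k)) ⟩
    0                      ∎

  χ-pow : ∀ E → χ (α ^ E) ≡ indicator (E % e ℕ.≟ 0)
  χ-pow E with E % e ℕ.≟ 0
  ... | yes E%e≡0 = indicator-yes (inD0? α e (α ^ E)) (power-in-D0 E E%e≡0)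
  ... | no E%e≢0 = indicator-no (inD0? α e (α ^ E)) (E%e≢0 ∘ power-in-D0⇒ E)

  χ-pow-shift : ∀ c j → χ (α ^ (c ℕ.+ j ℕ.* e)) ≡ indicator (c % e ℕ.≟ 0)
  χ-pow-shift c j =
    trans (χ-pow (c ℕ.+ j ℕ.* e)) (cong (λ r → indicator (r ℕ.≟ 0)) ([m+kn]%n≡m%n c j e))


dsrg-equation : ∀ {m I b s} → b +ℤ s ≡ m →
                s ≡ m *ℤ I +ℤ (m +ℤ -[1+ 0 ]) *ℤ b +ℤ m *ℤ (+ 1 -ℤ I -ℤ b)
dsrg-equation {m} {I} {b} {s} b+s≡m = begin
  s                                                        ≡⟨ isolate b s ⟩
  (b +ℤ s) -ℤ b                                            ≡⟨ cong (_-ℤ b) b+s≡m ⟩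
  m -ℤ b                                                   ≡⟨ expand m I b ⟩
  m *ℤ I +ℤ (m +ℤ -[1+ 0 ]) *ℤ b +ℤ m *ℤ (+ 1 -ℤ I -ℤ b)  ∎
  where
  open ≡-Reasoning
  isolate : ∀ b s → s ≡ (b +ℤ s) -ℤ b
  isolate = ℤSolver.solve-∀
  expand : ∀ m I b → m -ℤ b ≡ m *ℤ I +ℤ (m +ℤ -[1+ 0 ]) *ℤ b +ℤ m *ℤ (+ 1 -ℤ I -ℤ b)
  expand = ℤSolver.solve-∀


module BlockDSRG (e M : ℕ) .{{_ : NonZero e}} (F : FiniteField (suc (e ℕ.* M)))
                 (α : Fin (suc (e ℕ.* M))) where
  q : ℕ
  q = suc (e ℕ.* M)

  open FiniteField F
  open FieldFacts F
  open FiniteSums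
  open ClassIndicator F α e
  open ≡-Reasoning

  hits : (g : Fin e → Fin q) → Fin q → ℤ
  hits g v = ∑ (λ j → χ (g j * v))

  module _ (α≢0 : α ≢ 0#) (B : Fin e → Fin e → Fin q) (g h : Fin e → Fin q)
           (factor : ∀ i j → B i j ≡ g i * h j) (unit : ∀ j → h j * g j ≡ 1#)
           (transversal : ∀ v → v ≢ 0# → hits g v ≡ + 1) where

    vertex : Fin e → Fin q → Fin (e ℕ.* q)
    vertex = combine

    A : Mat (e ℕ.* q)
    A = blockC α e B

    entry : ∀ i x j y → A (vertex i x) (vertex j y) ≡ χ (x - B i j * y)
    entry i x j y = cong₂ (λ (i' , x') (j' , y') → χ (x' - B i' j' * y'))
                          (remQuot-combine {e} {q} i x) (remQuot-combine {e} {q} j y)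

    vertex-ind : (P : Fin (e ℕ.* q) → Set) → (∀ i x → P (vertex i x)) → ∀ u → P u
    vertex-ind P p u = subst P (combine-remQuot {e} q u) (p (proj₁ (remQuot {e} q u)) (proj₂ (remQuot {e} q u)))

    B≢0 : ∀ i j → B i j ≢ 0#
    B≢0 i j rewrite factor i j = *-≢0 (unit⇒≢0 (unit i)) (unit⇒≢0 (trans (*-comm (g j) (h j)) (unit j)))

    B-g : ∀ i j w → B i j * (g j * w) ≡ g i * w
    B-g i j w = begin
      B i j * (g j * w)        ≡⟨ cong (_* (g j * w)) (factor i j) ⟩
      (g i * h j) * (g j * w)  ≡⟨ *-assoc (g i) (h j) (g j * w) ⟩
      g i * (h j * (g j * w))  ≡⟨ cong (g i *_) (unit-cancel w (unit j)) ⟩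
      g i * w                  ∎

    g-shift : ∀ j k v z → g j * (v + h k * z) ≡ g j * v + B j k * z
    g-shift j k v z = begin
      g j * (v + h k * z)            ≡⟨ distribˡ (g j) v (h k * z) ⟩
      g j * v + g j * (h k * z)      ≡⟨ cong (λ t → g j * v + t) (sym (*-assoc (g j) (h k) z)) ⟩
      g j * v + (g j * h k) * z      ≡⟨ cong (λ t → g j * v + t * z) (sym (factor j k)) ⟩
      g j * v + B j k * z            ∎

    hits-zero : hits g 0# ≡ + 0
    hits-zero = begin
      ∑ (λ j → χ (g j * 0#))   ≡⟨ ∑-cong (λ j → trans (cong χ (zeroʳ (g j))) (χ-zero α≢0)) ⟩
      ∑ {e} (λ _ → + 0)        ≡⟨ ∑-const e (+ 0) ⟩
      + e *ℤ + 0               ≡⟨ ℤP.*-zeroʳ (+ e) ⟩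
      + 0                      ∎

    ∑-hits : ∀ (P : Fin q → ℤ) → ∑ (λ v → P v *ℤ hits g v) ≡ ∑ (λ j → P (punchIn 0# j))
    ∑-hits P = begin
      ∑ (λ v → P v *ℤ hits g v)
        ≡⟨ ∑-puncture 0# (λ v → P v *ℤ hits g v) ⟩
      P 0# *ℤ hits g 0# +ℤ ∑ (λ j → P (punchIn 0# j) *ℤ hits g (punchIn 0# j))
        ≡⟨ cong₂ _+ℤ_ (trans (cong (P 0# *ℤ_) hits-zero) (ℤP.*-zeroʳ (P 0#)))
                      (∑-cong (λ j → trans (cong (P (punchIn 0# j) *ℤ_) (transversal _ (punchInᵢ≢i 0# j)))
                                           (ℤP.*-identityʳ _))) ⟩
      + 0 +ℤ ∑ (λ j → P (punchIn 0# j))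
        ≡⟨ ℤP.+-identityˡ _ ⟩
      ∑ (λ j → P (punchIn 0# j)) ∎

    -- |D₀^e| = M: counting the pairs (j , v) with g_j v ∈ D₀^e in two ways.
    class-size : ∑ χ ≡ + M
    class-size = ℤP.*-cancelˡ-≡ (+ e) (∑ χ) (+ M) (begin
      + e *ℤ ∑ χ                                ≡⟨ sym (∑-const e (∑ χ)) ⟩
      ∑ {e} (λ _ → ∑ χ)                         ≡⟨ sym (∑-cong (λ j → ∑-scale χ (unit j))) ⟩
      ∑ (λ j → ∑ (λ v → χ (g j * v)))           ≡⟨ ∑-swap (λ j v → χ (g j * v)) ⟩
      ∑ (λ v → hits g v)                        ≡⟨ ∑-cong (λ v → sym (ℤP.*-identityˡ (hits g v))) ⟩
      ∑ (λ v → + 1 *ℤ hits g v)                 ≡⟨ ∑-hits (λ _ → + 1) ⟩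
      ∑ {e ℕ.* M} (λ _ → + 1)                   ≡⟨ ∑-const (e ℕ.* M) (+ 1) ⟩
      + (e ℕ.* M) *ℤ + 1                        ≡⟨ ℤP.*-identityʳ _ ⟩
      + (e ℕ.* M)                               ≡⟨ ℤP.pos-* e M ⟩
      + e *ℤ + M                                ∎)

    row-count : ∀ x i j → ∑ (λ y → χ (x - B i j * y)) ≡ + M
    row-count x i j = trans (∑-reflect χ x (inv-l (B≢0 i j))) class-size

    column-count : ∀ c → ∑ (λ y → χ (y - c)) ≡ + M
    column-count c = trans (∑-translate χ (- c)) class-size

    -- Substituting y = g_j (v + h_k z) in the count of 2-walks through block j.
    walks-through : ∀ i j k x z →
      ∑ (λ y → χ (x - B i j * y) *ℤ χ (y - B j k * z))
        ≡ ∑ (λ v → χ ((x - B i k * z) - g i * v) *ℤ χ (g j * v))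
    walks-through i j k x z = begin
      ∑ W                                     ≡⟨ sym (∑-scale W (unit j)) ⟩
      ∑ (λ v → W (g j * v))                   ≡⟨ sym (∑-translate (λ v → W (g j * v)) (h k * z)) ⟩
      ∑ (λ v → W (g j * (v + h k * z)))       ≡⟨ ∑-cong (λ v → cong₂ (λ s t → χ s *ℤ χ t) (first v) (second v)) ⟩
      ∑ (λ v → χ ((x - B i k * z) - g i * v) *ℤ χ (g j * v)) ∎
      where
      W : Fin q → ℤ
      W y = χ (x - B i j * y) *ℤ χ (y - B j k * z)
      first : ∀ v → x - B i j * (g j * (v + h k * z)) ≡ (x - B i k * z) - g i * v
      first v = begin
        x - B i j * (g j * (v + h k * z))   ≡⟨ cong (λ t → x - t) (B-g i j (v + h k * z)) ⟩
        x - g i * (v + h k * z)             ≡⟨ cong (λ t → x - t) (g-shift i k v z) ⟩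
        x - (g i * v + B i k * z)           ≡⟨ sub-+ x (g i * v) (B i k * z) ⟩
        (x - B i k * z) - g i * v           ∎
      second : ∀ v → g j * (v + h k * z) - B j k * z ≡ g j * v
      second v = trans (cong (λ t → t - B j k * z) (g-shift j k v z)) (add-sub-cancel (g j * v) (B j k * z))

    two-walks : ∀ i x k z → χ (x - B i k * z) +ℤ (A ⊗ A) (vertex i x) (vertex k z) ≡ + M
    two-walks i x k z = begin
      χ u +ℤ (A ⊗ A) (vertex i x) (vertex k z)
        ≡⟨ cong₂ _+ℤ_ (sym P0≡χu) walks ⟩
      P 0# +ℤ ∑ (λ j → P (punchIn 0# j))
        ≡⟨ sym (∑-puncture 0# P) ⟩
      ∑ P
        ≡⟨ trans (∑-reflect χ u (unit i)) class-size ⟩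
      + M ∎
      where
      u : Fin q
      u = x - B i k * z
      P : Fin q → ℤ
      P v = χ (u - g i * v)
      P0≡χu : P 0# ≡ χ u
      P0≡χu = cong χ (trans (cong (λ t → u - t) (zeroʳ (g i))) (sub-zero u))
      walks : (A ⊗ A) (vertex i x) (vertex k z) ≡ ∑ (λ j → P (punchIn 0# j))
      walks = begin
        ∑ (λ l → A (vertex i x) l *ℤ A l (vertex k z))
          ≡⟨ ∑-combine {e} {q} _ ⟩
        ∑ (λ j → ∑ (λ y → A (vertex i x) (vertex j y) *ℤ A (vertex j y) (vertex k z)))
          ≡⟨ ∑-cong (λ j → ∑-cong (λ y → cong₂ _*ℤ_ (entry i x j y) (entry j y k z))) ⟩
        ∑ (λ j → ∑ (λ y → χ (x - B i j * y) *ℤ χ (y - B j k * z)))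
          ≡⟨ ∑-cong (λ j → walks-through i j k x z) ⟩
        ∑ (λ j → ∑ (λ v → P v *ℤ χ (g j * v)))
          ≡⟨ ∑-swap (λ j v → P v *ℤ χ (g j * v)) ⟩
        ∑ (λ v → ∑ (λ j → P v *ℤ χ (g j * v)))
          ≡⟨ ∑-cong (λ v → ∑-*ˡ (P v) (λ j → χ (g j * v))) ⟩
        ∑ (λ v → P v *ℤ hits g v)
          ≡⟨ ∑-hits P ⟩
        ∑ (λ j → P (punchIn 0# j)) ∎

    blocks-of-M : ∑ {e} (λ _ → + M) ≡ + (e ℕ.* M) *ℤ + 1
    blocks-of-M = trans (∑-const e (+ M)) (trans (sym (ℤP.pos-* e M)) (sym (ℤP.*-identityʳ _)))

    out-degree : ∀ i x w → (A ⊗ Jₘ) (vertex i x) w ≡ + (e ℕ.* M) *ℤ Jₘ (vertex i x) w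
    out-degree i x w = begin
      ∑ (λ l → A (vertex i x) l *ℤ + 1)                  ≡⟨ ∑-cong (λ l → ℤP.*-identityʳ (A (vertex i x) l)) ⟩
      ∑ (A (vertex i x))                                 ≡⟨ ∑-combine {e} {q} _ ⟩
      ∑ (λ j → ∑ (λ y → A (vertex i x) (vertex j y)))    ≡⟨ ∑-cong (λ j → trans (∑-cong (entry i x j)) (row-count x i j)) ⟩
      ∑ {e} (λ _ → + M)                                  ≡⟨ blocks-of-M ⟩
      + (e ℕ.* M) *ℤ + 1                                 ∎

    in-degree : ∀ u k z → (Jₘ ⊗ A) u (vertex k z) ≡ + (e ℕ.* M) *ℤ Jₘ u (vertex k z)
    in-degree u k z = begin
      ∑ (λ l → + 1 *ℤ A l (vertex k z))                  ≡⟨ ∑-cong (λ l → ℤP.*-identityˡ (A l (vertex k z))) ⟩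
      ∑ (λ l → A l (vertex k z))                         ≡⟨ ∑-combine {e} {q} _ ⟩
      ∑ (λ j → ∑ (λ y → A (vertex j y) (vertex k z)))    ≡⟨ ∑-cong (λ j → trans (∑-cong (λ y → entry j y k z)) (column-count (B j k * z))) ⟩
      ∑ {e} (λ _ → + M)                                  ≡⟨ blocks-of-M ⟩
      + (e ℕ.* M) *ℤ + 1                                 ∎

    -- A² = MJ - A, which is the DSRG equation for (t, λ, μ) = (M, M - 1, M).
    theorem : IsDSRG (e ℕ.* q) (+ (e ℕ.* M)) (+ M) (+ M +ℤ -[1+ 0 ]) (+ M) A
    theorem = square , (λ u w → vertex-ind (λ u → RowSum u w) (λ i x → out-degree i x w) u)
                     , (λ u w → vertex-ind (ColumnSum u) (in-degree u) w)
      where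
      RowSum ColumnSum : Fin (e ℕ.* q) → Fin (e ℕ.* q) → Set
      RowSum u w = (A ⊗ Jₘ) u w ≡ + (e ℕ.* M) *ℤ Jₘ u w
      ColumnSum u w = (Jₘ ⊗ A) u w ≡ + (e ℕ.* M) *ℤ Jₘ u w
      Square : Fin (e ℕ.* q) → Fin (e ℕ.* q) → Set
      Square u w = (A ⊗ A) u w ≡ + M *ℤ Iₘ u w +ℤ (+ M +ℤ -[1+ 0 ]) *ℤ A u w +ℤ + M *ℤ (Jₘ u w -ℤ Iₘ u w -ℤ A u w)
      square : ∀ u w → Square u w
      square = vertex-ind (λ u → ∀ w → Square u w) λ i x →
               vertex-ind (Square (vertex i x)) λ k z →
               dsrg-equation (trans (cong (_+ℤ (A ⊗ A) (vertex i x) (vertex k z)) (entry i x k z)) (two-walks i x k z))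


∈D⇒exponent : ∀ {q} (F : FiniteField q) {x α : Fin q} {e i : ℕ} →
              FiniteField._∈D[_,_]_ F x e i α → ∃ λ k → x ≡ FiniteField._^_ F α (i ℕ.+ k ℕ.* e)
∈D⇒exponent F {x} {α} {e} {i} (k , x≡α^iα^ek) =
  k , trans x≡α^iα^ek (trans (sym (^-+ α i (e ℕ.* k))) (cong (λ t → α ^ (i ℕ.+ t)) (ℕP.*-comm e k)))
  where
  open FiniteField F
  open FieldFacts F

-- For r ∈ {1, 2} the residues 2r + s, s, r + s mod 3 are distinct, so exactly
-- one of them is 0.
exactly-one-multiple-of-3 : ∀ r s → r ≡ 1 ⊎ r ≡ 2 → s < 3 →
  indicator ((r ℕ.+ (r ℕ.+ s)) % 3 ℕ.≟ 0) +ℤ (indicator (s % 3 ℕ.≟ 0) +ℤ (indicator ((r ℕ.+ s) % 3 ℕ.≟ 0) +ℤ + 0))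
    ≡ + 1
exactly-one-multiple-of-3 .1 0 (inj₁ refl) _ = refl
exactly-one-multiple-of-3 .1 1 (inj₁ refl) _ = refl
exactly-one-multiple-of-3 .1 2 (inj₁ refl) _ = refl
exactly-one-multiple-of-3 .2 0 (inj₂ refl) _ = refl
exactly-one-multiple-of-3 .2 1 (inj₂ refl) _ = refl
exactly-one-multiple-of-3 .2 2 (inj₂ refl) _ = refl
exactly-one-multiple-of-3 _ (suc (suc (suc _))) _ (ℕ.s≤s (ℕ.s≤s (ℕ.s≤s ())))

exponent-av : ∀ r k s t → (r ℕ.+ k ℕ.* 3) ℕ.+ (s ℕ.+ t ℕ.* 3) ≡ (r ℕ.+ s) ℕ.+ (k ℕ.+ t) ℕ.* 3
exponent-av = ℕSolver.solve-∀

exponent-aav : ∀ r k s t → (r ℕ.+ k ℕ.* 3) ℕ.+ ((r ℕ.+ k ℕ.* 3) ℕ.+ (s ℕ.+ t ℕ.* 3))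
                           ≡ (r ℕ.+ (r ℕ.+ s)) ℕ.+ (k ℕ.+ (k ℕ.+ t)) ℕ.* 3
exponent-aav = ℕSolver.solve-∀

-- The matrix of Corollary 5.4 is B_ij = g_i h_j with g = (a², 1, a) and
-- h = (a⁻², 1, a⁻¹); for a = α^(r + 3k) with r ∈ {1, 2}, g is a transversal of
-- the cosets of D₀³ since its exponents 2r, 0, r are distinct mod 3.
module Corollary5p4Matrix (m : ℕ) .{{_ : NonZero m}} (F : FiniteField (suc (3 ℕ.* m)))
                          (α : Fin (suc (3 ℕ.* m))) (prim : FiniteField.IsPrimitive F α)
                          (a : Fin (suc (3 ℕ.* m))) (r k : ℕ)
                          (a≡α^ : a ≡ FiniteField._^_ F α (r ℕ.+ k ℕ.* 3)) (r∈12 : r ≡ 1 ⊎ r ≡ 2) where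
  open FiniteField F
  open FieldFacts F
  open ClassIndicator F α 3
  open CyclotomicPowers 3 m F α prim using (χ-pow-shift)
  open BlockDSRG 3 m F α using (hits; theorem)
  open ≡-Reasoning

  α≢0 : α ≢ 0#
  α≢0 = proj₁ prim

  a≢0 : a ≢ 0#
  a≢0 a≡0 = ^-≢0 (r ℕ.+ k ℕ.* 3) α≢0 (trans (sym a≡α^) a≡0)

  aa≢0 : a * a ≢ 0#
  aa≢0 = *-≢0 a≢0 a≢0

  g h : Fin 3 → Fin (suc (3 ℕ.* m))
  g 0F = a * a
  g 1F = 1#
  g 2F = a
  h 0F = inv (a * a)
  h 1F = 1#
  h 2F = inv a

  unit : ∀ j → h j * g j ≡ 1#
  unit 0F = inv-l aa≢0
  unit 1F = *-identityˡ 1#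
  unit 2F = inv-l a≢0

  a²a⁻¹≡a : (a * a) * inv a ≡ a
  a²a⁻¹≡a = trans (*-assoc a a (inv a)) (trans (cong (a *_) (inv-r a a≢0)) (*-identityʳ a))

  aa⁻²≡a⁻¹ : a * inv (a * a) ≡ inv a
  aa⁻²≡a⁻¹ = inv-unique (trans (sym (*-assoc a a (inv (a * a)))) (inv-r (a * a) aa≢0))

  factor : ∀ i j → matM F a i j ≡ g i * h j
  factor 0F 0F = sym (inv-r (a * a) aa≢0)
  factor 0F 1F = sym (*-identityʳ (a * a))
  factor 0F 2F = sym a²a⁻¹≡a
  factor 1F 0F = sym (*-identityˡ (inv (a * a)))
  factor 1F 1F = sym (*-identityˡ 1#)
  factor 1F 2F = sym (*-identityˡ (inv a))
  factor 2F 0F = sym aa⁻²≡a⁻¹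
  factor 2F 1F = sym (*-identityʳ a)
  factor 2F 2F = sym (inv-r a a≢0)

  a-times-power : ∀ E → a * α ^ E ≡ α ^ ((r ℕ.+ k ℕ.* 3) ℕ.+ E)
  a-times-power E = trans (cong (_* α ^ E) a≡α^) (sym (^-+ α (r ℕ.+ k ℕ.* 3) E))

  χ-at-power : ∀ {x} E c j → x ≡ α ^ E → E ≡ c ℕ.+ j ℕ.* 3 → χ x ≡ indicator (c % 3 ℕ.≟ 0)
  χ-at-power E c j x≡α^E E≡c+3j = trans (cong χ (trans x≡α^E (cong (α ^_) E≡c+3j))) (χ-pow-shift c j)

  transversal : ∀ v → v ≢ 0# → hits g v ≡ + 1
  transversal v v≢0 = begin
    χ ((a * a) * v) +ℤ (χ (1# * v) +ℤ (χ (a * v) +ℤ + 0))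
      ≡⟨ cong₂ _+ℤ_ (χ-at-power (A ℕ.+ (A ℕ.+ n)) (r ℕ.+ (r ℕ.+ s)) (k ℕ.+ (k ℕ.+ t)) aav≡ aav-exponent)
                    (cong₂ (λ y z → y +ℤ (z +ℤ + 0))
                           (χ-at-power n s t (trans (*-identityˡ v) v≡α^n) n≡s+3t)
                           (χ-at-power (A ℕ.+ n) (r ℕ.+ s) (k ℕ.+ t) av≡ av-exponent)) ⟩
    indicator ((r ℕ.+ (r ℕ.+ s)) % 3 ℕ.≟ 0) +ℤ (indicator (s % 3 ℕ.≟ 0) +ℤ (indicator ((r ℕ.+ s) % 3 ℕ.≟ 0) +ℤ + 0))
      ≡⟨ exactly-one-multiple-of-3 r s r∈12 (m%n<n n 3) ⟩
    + 1 ∎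
    where
    A n s t : ℕ
    A = r ℕ.+ k ℕ.* 3
    n = proj₁ (proj₂ prim v v≢0)
    s = n % 3
    t = n / 3
    v≡α^n : v ≡ α ^ n
    v≡α^n = proj₂ (proj₂ prim v v≢0)
    n≡s+3t : n ≡ s ℕ.+ t ℕ.* 3
    n≡s+3t = m≡m%n+[m/n]*n n 3
    av≡ : a * v ≡ α ^ (A ℕ.+ n)
    av≡ = trans (cong (a *_) v≡α^n) (a-times-power n)
    aav≡ : (a * a) * v ≡ α ^ (A ℕ.+ (A ℕ.+ n))
    aav≡ = trans (*-assoc a a v) (trans (cong (a *_) av≡) (a-times-power (A ℕ.+ n)))
    av-exponent : A ℕ.+ n ≡ (r ℕ.+ s) ℕ.+ (k ℕ.+ t) ℕ.* 3
    av-exponent = trans (cong (A ℕ.+_) n≡s+3t) (exponent-av r k s t)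
    aav-exponent : A ℕ.+ (A ℕ.+ n) ≡ (r ℕ.+ (r ℕ.+ s)) ℕ.+ (k ℕ.+ (k ℕ.+ t)) ℕ.* 3
    aav-exponent = trans (cong (λ n → A ℕ.+ (A ℕ.+ n)) n≡s+3t) (exponent-aav r k s t)

  dsrg : IsDSRG (3 ℕ.* suc (3 ℕ.* m)) (+ (3 ℕ.* m)) (+ m) (+ m +ℤ -[1+ 0 ]) (+ m) (blockC α 3 (matM F a))
  dsrg = theorem α≢0 (matM F a) g h factor unit transversal


-- The case m = 0 is void
-- (no field has one element); otherwise a ∈ D_r³ gives a = α^(r + 3k).
corollary-for : ∀ m (F : FiniteField (suc (3 ℕ.* m))) (α : Fin (suc (3 ℕ.* m))) →
  FiniteField.IsPrimitive F α → (a : Fin (suc (3 ℕ.* m))) →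
  (FiniteField._∈D[_,_]_ F a 3 1 α ⊎ FiniteField._∈D[_,_]_ F a 3 2 α) →
  IsDSRG (3 ℕ.* suc (3 ℕ.* m)) (+ (3 ℕ.* m)) (+ m) (+ m +ℤ -[1+ 0 ]) (+ m) (FiniteField.blockC F α 3 (matM F a))
corollary-for zero F _ _ _ _ = ⊥-elim (no-field-of-size-one F)
corollary-for m@(suc _) F α prim a (inj₁ a∈D₁) =
  let k , a≡α^ = ∈D⇒exponent F {α = α} {e = 3} {i = 1} a∈D₁
  in Corollary5p4Matrix.dsrg m F α prim a 1 k a≡α^ (inj₁ refl)
corollary-for m@(suc _) F α prim a (inj₂ a∈D₂) =
  let k , a≡α^ = ∈D⇒exponent F {α = α} {e = 3} {i = 2} a∈D₂
  in Corollary5p4Matrix.dsrg m F α prim a 2 k a≡α^ (inj₂ refl)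

open import Data.Nat using (_+_; _*_)

corollary5p4 : (q m : ℕ) → IsPrimePower q → q ≡ 3 * m + 1 →
    (F : FiniteField q) (α : Fin q) → FiniteField.IsPrimitive F α →
    (a : Fin q) →
    (FiniteField._∈D[_,_]_ F a 3 1 α ⊎ FiniteField._∈D[_,_]_ F a 3 2 α) →
    IsDSRG (3 * q) (+ (3 * m)) (+ m) (+ m +ℤ -[1+ 0 ]) (+ m)
      (FiniteField.blockC F α 3 (matM F a))
corollary5p4 q m _ q≡3m+1 with trans q≡3m+1 (ℕP.+-comm (3 * m) 1)
... | refl = corollary-for m
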